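{- For every integer $k \geq 1$, let $\mathcal{P}(k)$ denote the greatest common divisor of all the integers $\sum_{i=1}^{k} P_{n+i}$ for $n \geq 0$. Then $$\mathcal{P}(k) = \begin{cases} 2P_{k/2}, & \text{if } k \equiv 0 \pmod 4;\\ Q_{k/2}, & \text{if } k \equiv 2 \pmod 4;\\ 1, & \text{if } k \equiv 1,3 \pmod 4.\end{cases}$$
   Context: The Pell sequence $(P_n)_{n\ge 0}$ is defined by $P_0=0$, $P_1=1$, $P_n=2P_{n-1}+P_{n-2}$ for $n\ge 2$. The associated Pell sequence $(Q_n)_{n\ge 0}$ is defined by $Q_0=1$, $Q_1=1$, $Q_n=2Q_{n-1}+Q_{n-2}$ for $n\ge 2$. -}

module Defs where

open import Data.Nat using (ℕ; zero; suc; _+_; _*_)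
open import Data.Nat.Divisibility using (_∣_)
open import Data.Product using (_×_)

P : ℕ → ℕ
P zero = 0
P (suc zero) = 1
P (suc (suc n)) = 2 * P (suc n) + P n

Q : ℕ → ℕ
Q zero = 1
Q (suc zero) = 1
Q (suc (suc n)) = 2 * Q (suc n) + Q n

sumP : ℕ → ℕ → ℕ
sumP n zero = 0
sumP n (suc k) = sumP n k + P (n + suc k)

IsGCDOfAll : (ℕ → ℕ) → ℕ → Set
IsGCDOfAll f d = (∀ n → d ∣ f n) × (∀ m → (∀ n → m ∣ f n) → m ∣ d)

-- Writing (1 + √2)ᵐ = Q m + P m √2 gives addition formulas for P and Q and
-- the Pell identity Q m² − 2 P m² = (−1)ᵐ. By the addition formula every
-- window sum Σᵢ₌₁ᵏ P (n + i) is an integer combination of P (n + 1) and P n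
-- with coefficients Σᵢ₌₁ᵏ P i and T k = Σᵢ₌₀ᵏ⁻¹ P i (sumP< k), so the gcd of all window
-- sums is gcd (T k) (P k). Moreover Q k = 2 T k + 1, so for odd k the Pell
-- identity reads P k² = T k (2 T k + 2) + 1 and the gcd is 1, while for
-- k = 2m doubling gives P k = 2 P m Q m and T k = 2 P m² (m even) or Q m²
-- (m odd), whose gcd is 2 P m resp. Q m because P m and Q m, resp. Q m and
-- 2 P m, are coprime by the Pell identity.
module Submission where

open import Defs
open import Data.Nat using (ℕ; _+_; _*_; _/_; _%_; _≥_)
open import Relation.Binary.PropositionalEquality using (_≡_)
open import Data.Product using (_×_)

open import Data.Nat using (zero; suc)
open import Data.Nat.Properties using (+-identityʳ; *-identityʳ; *-comm; +-cancelʳ-≡; *-cancelˡ-≡)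
open import Data.Nat.Divisibility
  using (_∣_; ∣-trans; ∣1⇒≡1; ∣m∣n⇒∣m+n; ∣m+n∣m⇒∣n; ∣m⇒∣m*n; ∣n⇒∣m*n; m∣m*n; n∣m*n)
open import Data.Nat.GCD using (GCD; module GCD)
open import Data.Nat.Coprimality using (Coprime; coprime⇒GCD≡1; coprime-factors)
import Data.Nat.Coprimality as Coprime
open import Data.Nat.DivMod using (m≡m%n+[m/n]*n; m*n/n≡m)
open import Data.Nat.Tactic.RingSolver using (solve-∀)
open import Data.Product using (_,_; proj₁; proj₂)
open import Relation.Binary.PropositionalEquality
  using (refl; sym; trans; cong; cong₂; subst; subst₂; module ≡-Reasoning)
open ≡-Reasoning

P-suc : ∀ n → P (suc n) ≡ Q n + P n
P-suc zero = refl
P-suc (suc zero) = refl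
P-suc (suc (suc n)) =
  trans (cong₂ (λ a b → 2 * a + b) (P-suc (suc n)) (P-suc n)) (regroup (Q (suc n)) (P (suc n)) (Q n) (P n))
  where
  regroup : ∀ q₁ p₁ q₀ p₀ → 2 * (q₁ + p₁) + (q₀ + p₀) ≡ (2 * q₁ + q₀) + (2 * p₁ + p₀)
  regroup = solve-∀

Q-suc : ∀ n → Q (suc n) ≡ Q n + 2 * P n
Q-suc zero = refl
Q-suc (suc zero) = refl
Q-suc (suc (suc n)) =
  trans (cong₂ (λ a b → 2 * a + b) (Q-suc (suc n)) (Q-suc n)) (regroup (Q (suc n)) (P (suc n)) (Q n) (P n))
  where
  regroup : ∀ q₁ p₁ q₀ p₀ → 2 * (q₁ + 2 * p₁) + (q₀ + 2 * p₀) ≡ (2 * q₁ + q₀) + 2 * (2 * p₁ + p₀)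
  regroup = solve-∀

Q-+ : ∀ m n → Q (m + n) ≡ Q m * Q n + 2 * (P m * P n)
P-+ : ∀ m n → P (m + n) ≡ Q m * P n + P m * Q n

Q-+ zero n = sym (trans (+-identityʳ _) (+-identityʳ _))
Q-+ (suc m) n = begin
  Q (suc (m + n))                                   ≡⟨ Q-suc (m + n) ⟩
  Q (m + n) + 2 * P (m + n)                         ≡⟨ cong₂ (λ a b → a + 2 * b) (Q-+ m n) (P-+ m n) ⟩
  (Q m * Q n + 2 * (P m * P n)) + 2 * (Q m * P n + P m * Q n)
                                                    ≡⟨ expand (Q m) (P m) (Q n) (P n) ⟩
  (Q m + 2 * P m) * Q n + 2 * ((Q m + P m) * P n)   ≡⟨ cong₂ (λ a b → a * Q n + 2 * (b * P n)) (sym (Q-suc m)) (sym (P-suc m)) ⟩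
  Q (suc m) * Q n + 2 * (P (suc m) * P n)           ∎
  where
  expand : ∀ a b c d → (a * c + 2 * (b * d)) + 2 * (a * d + b * c) ≡ (a + 2 * b) * c + 2 * ((a + b) * d)
  expand = solve-∀

P-+ zero n = sym (trans (+-identityʳ _) (+-identityʳ _))
P-+ (suc m) n = begin
  P (suc (m + n))                                   ≡⟨ P-suc (m + n) ⟩
  Q (m + n) + P (m + n)                             ≡⟨ cong₂ _+_ (Q-+ m n) (P-+ m n) ⟩
  (Q m * Q n + 2 * (P m * P n)) + (Q m * P n + P m * Q n)
                                                    ≡⟨ expand (Q m) (P m) (Q n) (P n) ⟩
  (Q m + 2 * P m) * P n + (Q m + P m) * Q n         ≡⟨ cong₂ (λ a b → a * P n + b * Q n) (sym (Q-suc m)) (sym (P-suc m)) ⟩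
  Q (suc m) * P n + P (suc m) * Q n                 ∎
  where
  expand : ∀ a b c d → (a * c + 2 * (b * d)) + (a * d + b * c) ≡ (a + 2 * b) * d + (a + b) * c
  expand = solve-∀

P-+-suc : ∀ m n → P (m + suc n) ≡ P (suc m) * P (suc n) + P m * P n
P-+-suc m n = begin
  P (m + suc n)                                 ≡⟨ P-+ m (suc n) ⟩
  Q m * P (suc n) + P m * Q (suc n)             ≡⟨ cong₂ (λ a b → Q m * a + P m * b) (P-suc n) (Q-suc n) ⟩
  Q m * (Q n + P n) + P m * (Q n + 2 * P n)     ≡⟨ regroup (Q m) (P m) (Q n) (P n) ⟩
  (Q m + P m) * (Q n + P n) + P m * P n         ≡⟨ cong₂ (λ a b → a * b + P m * P n) (sym (P-suc m)) (sym (P-suc n)) ⟩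
  P (suc m) * P (suc n) + P m * P n             ∎
  where
  regroup : ∀ a b c d → a * (c + d) + b * (c + 2 * d) ≡ (a + b) * (c + d) + b * d
  regroup = solve-∀

P-double : ∀ m → P (m + m) ≡ 2 * P m * Q m
P-double m = trans (P-+ m m) (sum-of-twins (Q m) (P m))
  where
  sum-of-twins : ∀ q p → q * p + p * q ≡ 2 * p * q
  sum-of-twins = solve-∀

-- Q m² − 2 P m² changes sign from m to m + 1; a and b carry its value in ℕ.
Pell-step : ∀ {a b} m → Q m * Q m + a ≡ 2 * (P m * P m) + b →
            Q (suc m) * Q (suc m) + b ≡ 2 * (P (suc m) * P (suc m)) + a
Pell-step {a} {b} m pell = +-cancelʳ-≡ (Q m * Q m + a) _ _ (begin
  Q′ * Q′ + b + (Q m * Q m + a)                 ≡⟨ shuffle (Q′ * Q′) (Q m * Q m) a b ⟩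
  (Q′ * Q′ + Q m * Q m) + (a + b)               ≡⟨ cong (_+ (a + b)) squares ⟩
  (2 * (P′ * P′) + 2 * (P m * P m)) + (a + b)   ≡⟨ reshuffle (2 * (P′ * P′)) (2 * (P m * P m)) a b ⟩
  2 * (P′ * P′) + a + (2 * (P m * P m) + b)     ≡⟨ cong (2 * (P′ * P′) + a +_) (sym pell) ⟩
  2 * (P′ * P′) + a + (Q m * Q m + a)           ∎)
  where
  Q′ = Q (suc m)
  P′ = P (suc m)
  squares : Q′ * Q′ + Q m * Q m ≡ 2 * (P′ * P′) + 2 * (P m * P m)
  squares = begin
    Q′ * Q′ + Q m * Q m                                   ≡⟨ cong (λ q → q * q + Q m * Q m) (Q-suc m) ⟩
    (Q m + 2 * P m) * (Q m + 2 * P m) + Q m * Q m          ≡⟨ expand (Q m) (P m) ⟩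
    2 * ((Q m + P m) * (Q m + P m)) + 2 * (P m * P m)      ≡⟨ cong (λ p → 2 * (p * p) + 2 * (P m * P m)) (sym (P-suc m)) ⟩
    2 * (P′ * P′) + 2 * (P m * P m)                        ∎
    where
    expand : ∀ q p → (q + 2 * p) * (q + 2 * p) + q * q ≡ 2 * ((q + p) * (q + p)) + 2 * (p * p)
    expand = solve-∀
  shuffle : ∀ x u a b → x + b + (u + a) ≡ (x + u) + (a + b)
  shuffle = solve-∀
  reshuffle : ∀ y v a b → (y + v) + (a + b) ≡ y + a + (v + b)
  reshuffle = solve-∀

Pell-even : ∀ j → Q (j * 2) * Q (j * 2) ≡ 2 * (P (j * 2) * P (j * 2)) + 1
Pell-odd : ∀ j → Q (suc (j * 2)) * Q (suc (j * 2)) + 1 ≡ 2 * (P (suc (j * 2)) * P (suc (j * 2)))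

Pell-even zero = refl
Pell-even (suc j) = trans (sym (+-identityʳ _)) (Pell-step (suc (j * 2)) (trans (Pell-odd j) (sym (+-identityʳ _))))

Pell-odd j = trans (Pell-step (j * 2) (trans (+-identityʳ _) (Pell-even j))) (+-identityʳ _)

∣≡∣+1⇒coprime : ∀ {a c u v} → a ∣ u → c ∣ v → u ≡ v + 1 → Coprime a c
∣≡∣+1⇒coprime {u = u} a∣u c∣v u≡v+1 (x∣a , x∣c) =
  ∣1⇒≡1 (∣m+n∣m⇒∣n (subst (_ ∣_) u≡v+1 (∣-trans x∣a a∣u)) (∣-trans x∣c c∣v))

GCD-*-coprime : ∀ {a b} c → Coprime a b → GCD (a * c) (b * c) c
GCD-*-coprime {a} {b} c coprime = GCD.is (n∣m*n a , n∣m*n b) (coprime-factors coprime)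

sumP< : ℕ → ℕ
sumP< zero = 0
sumP< (suc k) = sumP< k + P k

sumP0≡sumP<+P : ∀ k → sumP 0 k ≡ sumP< k + P k
sumP0≡sumP<+P zero = refl
sumP0≡sumP<+P (suc k) = cong (_+ P (suc k)) (sumP0≡sumP<+P k)

Q≡2sumP<+1 : ∀ k → Q k ≡ 2 * sumP< k + 1
Q≡2sumP<+1 zero = refl
Q≡2sumP<+1 (suc k) =
  trans (Q-suc k) (trans (cong (_+ 2 * P k) (Q≡2sumP<+1 k)) (regroup (sumP< k) (P k)))
  where
  regroup : ∀ t p → 2 * t + 1 + 2 * p ≡ 2 * (t + p) + 1
  regroup = solve-∀

sumP-split : ∀ n k → sumP n k ≡ sumP 0 k * P (suc n) + sumP< k * P n
sumP-split n zero = refl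
sumP-split n (suc k) = begin
  sumP n k + P (n + suc k)                                  ≡⟨ cong₂ _+_ (sumP-split n k) (P-+-suc n k) ⟩
  (sumP 0 k * P (suc n) + sumP< k * P n) + (P (suc n) * P (suc k) + P n * P k)
                                                            ≡⟨ regroup (sumP 0 k) (sumP< k) (P (suc n)) (P n) (P (suc k)) (P k) ⟩
  (sumP 0 k + P (suc k)) * P (suc n) + (sumP< k + P k) * P n ∎
  where
  regroup : ∀ s t a b c d → (s * a + t * b) + (a * c + b * d) ≡ (s + c) * a + (t + d) * b
  regroup = solve-∀

GCD⇒IsGCDOfAll-sumP : ∀ {k d} → GCD (sumP< k) (P k) d → IsGCDOfAll (λ n → sumP n k) d
GCD⇒IsGCDOfAll-sumP {k} {d} gcd = divides-all , greatest
  where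
  d∣sumP< = proj₁ (GCD.commonDivisor gcd)
  d∣P = proj₂ (GCD.commonDivisor gcd)
  d∣sumP0 : d ∣ sumP 0 k
  d∣sumP0 = subst (d ∣_) (sym (sumP0≡sumP<+P k)) (∣m∣n⇒∣m+n d∣sumP< d∣P)
  divides-all : ∀ n → d ∣ sumP n k
  divides-all n = subst (d ∣_) (sym (sumP-split n k)) (∣m∣n⇒∣m+n (∣m⇒∣m*n _ d∣sumP0) (∣m⇒∣m*n _ d∣sumP<))
  greatest : ∀ x → (∀ n → x ∣ sumP n k) → x ∣ d
  greatest x x∣sumP = GCD.greatest gcd (x∣sumP< , x∣P)
    where
    x∣sumP< : x ∣ sumP< k
    x∣sumP< = subst (x ∣_) (*-identityʳ _)
      (∣m+n∣m⇒∣n (subst (x ∣_) (sumP-split 1 k) (x∣sumP 1)) (∣m⇒∣m*n 2 (x∣sumP 0)))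
    x∣P : x ∣ P k
    x∣P = ∣m+n∣m⇒∣n (subst (x ∣_) (sumP0≡sumP<+P k) (x∣sumP 0)) x∣sumP<

coprime-sumP<-P-odd : ∀ j → Coprime (sumP< (suc (j * 2))) (P (suc (j * 2)))
coprime-sumP<-P-odd j = Coprime.sym (∣≡∣+1⇒coprime (m∣m*n (P k)) (m∣m*n (2 * t + 2)) P²≡)
  where
  k = suc (j * 2)
  t = sumP< k
  P²≡ : P k * P k ≡ t * (2 * t + 2) + 1
  P²≡ = *-cancelˡ-≡ _ _ 2 (begin
    2 * (P k * P k)                ≡⟨ sym (Pell-odd j) ⟩
    Q k * Q k + 1                  ≡⟨ cong (λ q → q * q + 1) (Q≡2sumP<+1 k) ⟩
    (2 * t + 1) * (2 * t + 1) + 1  ≡⟨ expand t ⟩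
    2 * (t * (2 * t + 2) + 1)      ∎)
    where
    expand : ∀ t → (2 * t + 1) * (2 * t + 1) + 1 ≡ 2 * (t * (2 * t + 2) + 1)
    expand = solve-∀

sumP<-double : ∀ m → 2 * sumP< (m + m) + 1 ≡ Q m * Q m + 2 * (P m * P m)
sumP<-double m = trans (sym (Q≡2sumP<+1 (m + m))) (Q-+ m m)

sumP<-double-even : ∀ j → let m = j * 2 in sumP< (m + m) ≡ P m * (2 * P m)
sumP<-double-even j = *-cancelˡ-≡ _ _ 2 (+-cancelʳ-≡ 1 _ _ (begin
  2 * sumP< (m + m) + 1                   ≡⟨ sumP<-double m ⟩
  Q m * Q m + 2 * (P m * P m)             ≡⟨ cong (_+ 2 * (P m * P m)) (Pell-even j) ⟩
  2 * (P m * P m) + 1 + 2 * (P m * P m)   ≡⟨ regroup (P m) ⟩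
  2 * (P m * (2 * P m)) + 1               ∎))
  where
  m = j * 2
  regroup : ∀ p → 2 * (p * p) + 1 + 2 * (p * p) ≡ 2 * (p * (2 * p)) + 1
  regroup = solve-∀

sumP<-double-odd : ∀ j → let m = suc (j * 2) in sumP< (m + m) ≡ Q m * Q m
sumP<-double-odd j = *-cancelˡ-≡ _ _ 2 (+-cancelʳ-≡ 1 _ _ (begin
  2 * sumP< (m + m) + 1                   ≡⟨ sumP<-double m ⟩
  Q m * Q m + 2 * (P m * P m)             ≡⟨ cong (Q m * Q m +_) (sym (Pell-odd j)) ⟩
  Q m * Q m + (Q m * Q m + 1)             ≡⟨ regroup (Q m) ⟩
  2 * (Q m * Q m) + 1                     ∎))
  where
  m = suc (j * 2)
  regroup : ∀ q → q * q + (q * q + 1) ≡ 2 * (q * q) + 1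
  regroup = solve-∀

gcd-sumP-odd : ∀ j → IsGCDOfAll (λ n → sumP n (suc (j * 2))) 1
gcd-sumP-odd j = GCD⇒IsGCDOfAll-sumP (coprime⇒GCD≡1 (coprime-sumP<-P-odd j))

gcd-sumP-double-even : ∀ j → let m = j * 2 in IsGCDOfAll (λ n → sumP n (m + m)) (2 * P m)
gcd-sumP-double-even j = GCD⇒IsGCDOfAll-sumP {m + m}
  (subst₂ (λ x y → GCD x y (2 * P m)) (sym (sumP<-double-even j)) (sym P≡)
    (GCD-*-coprime (2 * P m) (Coprime.sym coprime-Q-P)))
  where
  m = j * 2
  P≡ : P (m + m) ≡ Q m * (2 * P m)
  P≡ = trans (P-double m) (*-comm (2 * P m) (Q m))
  coprime-Q-P : Coprime (Q m) (P m)
  coprime-Q-P = ∣≡∣+1⇒coprime (m∣m*n (Q m)) (∣n⇒∣m*n 2 (m∣m*n (P m))) (Pell-even j)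

gcd-sumP-double-odd : ∀ j → let m = suc (j * 2) in IsGCDOfAll (λ n → sumP n (m + m)) (Q m)
gcd-sumP-double-odd j = GCD⇒IsGCDOfAll-sumP {m + m}
  (subst₂ (λ x y → GCD x y (Q m)) (sym (sumP<-double-odd j)) (sym (P-double m))
    (GCD-*-coprime (Q m) (Coprime.sym coprime-2P-Q)))
  where
  m = suc (j * 2)
  coprime-2P-Q : Coprime (2 * P m) (Q m)
  coprime-2P-Q =
    ∣≡∣+1⇒coprime (subst (2 * P m ∣_) (*-assoc′ (P m)) (m∣m*n (P m))) (m∣m*n (Q m)) (sym (Pell-odd j))
    where
    *-assoc′ : ∀ p → 2 * p * p ≡ 2 * (p * p)
    *-assoc′ = solve-∀

at-double : ∀ {k} m (d : ℕ → ℕ) → k ≡ m * 2 →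
            IsGCDOfAll (λ n → sumP n (m + m)) (d m) → IsGCDOfAll (λ n → sumP n k) (d (k / 2))
at-double m d refl =
  subst₂ (λ k x → IsGCDOfAll (λ n → sumP n k) (d x)) (m+m≡m*2 m) (sym (m*n/n≡m m 2))
  where
  m+m≡m*2 : ∀ m → m + m ≡ m * 2
  m+m≡m*2 = solve-∀

theorem15 : ∀ (k : ℕ) → k ≥ 1 →
    (k % 4 ≡ 0 → IsGCDOfAll (λ n → sumP n k) (2 * P (k / 2)))
    × ((k % 4 ≡ 2 → IsGCDOfAll (λ n → sumP n k) (Q (k / 2)))
    × ((k % 4 ≡ 1 → IsGCDOfAll (λ n → sumP n k) 1)
    × (k % 4 ≡ 3 → IsGCDOfAll (λ n → sumP n k) 1)))
theorem15 k _ =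
    (λ h → at-double (j * 2) (λ m → 2 * P m) (k≡ h (4j≡[2j]*2 j)) (gcd-sumP-double-even j))
  , (λ h → at-double (suc (j * 2)) Q (k≡ h (4j+2≡[2j+1]*2 j)) (gcd-sumP-double-odd j))
  , (λ h → subst (λ k′ → IsGCDOfAll (λ n → sumP n k′) 1) (sym (k≡ h (4j+1≡2j+1 j))) (gcd-sumP-odd (j * 2)))
  , (λ h → subst (λ k′ → IsGCDOfAll (λ n → sumP n k′) 1) (sym (k≡ h (4j+3≡2j+3 j))) (gcd-sumP-odd (suc (j * 2))))
  where
  j = k / 4
  k≡ : ∀ {r k′} → k % 4 ≡ r → r + j * 4 ≡ k′ → k ≡ k′
  k≡ h eq = trans (m≡m%n+[m/n]*n k 4) (trans (cong (_+ j * 4) h) eq)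
  4j≡[2j]*2 : ∀ j → 0 + j * 4 ≡ j * 2 * 2
  4j≡[2j]*2 = solve-∀
  4j+2≡[2j+1]*2 : ∀ j → 2 + j * 4 ≡ suc (j * 2) * 2
  4j+2≡[2j+1]*2 = solve-∀
  4j+1≡2j+1 : ∀ j → 1 + j * 4 ≡ suc (j * 2 * 2)
  4j+1≡2j+1 = solve-∀
  4j+3≡2j+3 : ∀ j → 3 + j * 4 ≡ suc (suc (j * 2) * 2)
  4j+3≡2j+3 = solve-∀
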